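{- Let $G=(V,E)$ be a loop-free multigraph. If $\sigma$ is a uniformly random vertex order of $G$, then $\mathbb{E}\left[\sum_{v\in V}\overleftarrow{d}_\sigma(v)\overrightarrow{d}_\sigma(v)\right]\ge \frac13\max_{\tau}\sum_{v\in V}\overleftarrow{d}_\tau(v)\overrightarrow{d}_\tau(v)$, where the maximum is over all vertex orders $\tau$ of $G$.
   Context: A vertex order is a linear ordering $\sigma=(\sigma_1,\dots,\sigma_n)$ of $V$; for $v=\sigma_i$, the left-degree $\overleftarrow{d}_\sigma(v)$ is the number of edges (with multiplicity) joining $v$ to $\{\sigma_1,\dots,\sigma_{i-1}\}$ and the right-degree $\overrightarrow{d}_\sigma(v)$ is the number of edges joining $v$ to $\{\sigma_{i+1},\dots,\sigma_n\}$. -}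

module Defs where

open import Data.Nat using (ℕ; zero; suc; _+_; _*_)
open import Data.Fin using (Fin)
open import Data.List using (List; []; _∷_; [_]; _++_; map; concatMap)
open import Data.Nat.ListAction using (sum)
open import Relation.Binary.PropositionalEquality using (_≡_)

-- A loop-free multigraph on vertex set V = Fin n, given by its edge
-- multiplicity function: mult u v = number of edges joining u and v.
record Multigraph (n : ℕ) : Set where
  field
    mult      : Fin n → Fin n → ℕ
    symmetric : ∀ u v → mult u v ≡ mult v u
    loopFree  : ∀ v → mult v v ≡ 0

open Multigraph public

edgesTo : ∀ {n} → Multigraph n → Fin n → List (Fin n) → ℕ
edgesTo G v S = sum (map (mult G v) S)

-- A vertex order is a list σ = (σ₁,…,σₙ) enumerating V (a permutation of allFin n).
-- score G σ = Σ_i  (left-degree of σ_i) * (right-degree of σ_i),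
-- computed by scanning σ with the prefix 'pre' of earlier vertices.
scoreFrom : ∀ {n} → Multigraph n → List (Fin n) → List (Fin n) → ℕ
scoreFrom G pre []         = 0
scoreFrom G pre (v ∷ post) = edgesTo G v pre * edgesTo G v post + scoreFrom G (pre ++ [ v ]) post

score : ∀ {n} → Multigraph n → List (Fin n) → ℕ
score G σ = scoreFrom G [] σ

insertions : ∀ {A : Set} → A → List A → List (List A)
insertions x []       = (x ∷ []) ∷ []
insertions x (y ∷ ys) = (x ∷ y ∷ ys) ∷ map (y ∷_) (insertions x ys)

-- list of all permutations of a list (each exactly once, for distinct entries)
perms : ∀ {A : Set} → List A → List (List A)
perms []       = [] ∷ []
perms (x ∷ xs) = concatMap (insertions x) (perms xs)

{-# OPTIONS --safe #-}
-- Write score σ as a sum over the 3-element sublists a b c of σ (taken in σ-order) of the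
-- wedge weight mult b a * mult b c.  Summing over all n! orders, every 3-set of vertices
-- occurs in each of its 6 orders equally often (the case k = 3 of the double count
-- k! * Σ_σ Σ_{k-sublists of σ} h = n! * Σ_{k-sublists s of V} Σ_{orders of s} h), so
-- 6 * Σ_σ score σ is n! times the sum of all wedge weights over all ordered triples.
-- For a fixed τ each 3-set contributes the weight of one order, and the reversed order
-- has the same middle vertex and hence the same weight, so 2 * score τ is at most the
-- inner sum and 2 * n! * score τ ≤ 6 * Σ_σ score σ.
module Submission where

open import Defs
open import Data.Nat using (ℕ; zero; suc; _+_; _*_; _≤_; z≤n; _!)
open import Data.Nat.Properties
  using ( +-assoc; +-comm; +-identityʳ; *-identityˡ; *-identityʳ; *-zeroʳ; *-comm; *-assoc
        ; *-distribˡ-+; *-distribʳ-+; *-commutativeSemigroup; suc-injective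
        ; *-cancelˡ-≤; *-monoʳ-≤; +-mono-≤; ≤-refl; m≤m+n; module ≤-Reasoning )
open import Data.Nat.ListAction using (sum)
open import Data.Nat.Tactic.RingSolver using (solve-∀)
open import Data.Fin using (Fin)
open import Data.List using (List; []; _∷_; [_]; _++_; map; concatMap; length; allFin)
open import Data.List.Relation.Binary.Permutation.Propositional as ↭ using (_↭_; ↭-sym)
open import Data.List.Relation.Binary.Permutation.Propositional.Properties using (↭-length)
open import Data.Product using (_×_; _,_; uncurry; map₂)
open import Function using (_∘_)
open import Algebra.Properties.CommutativeSemigroup *-commutativeSemigroup using (x∙yz≈y∙xz)
open import Relation.Binary.PropositionalEquality
  using (_≡_; refl; sym; trans; cong; cong₂; subst; module ≡-Reasoning)

∑ : {B : Set} → List B → (B → ℕ) → ℕ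
∑ xs f = sum (map f xs)

syntax ∑ xs (λ x → e) = ∑[ x ∈ xs ] e

module _ {B : Set} where

  ∑-cong : ∀ (xs : List B) {f g : B → ℕ} → (∀ x → f x ≡ g x) → ∑ xs f ≡ ∑ xs g
  ∑-cong []       f≡g = refl
  ∑-cong (x ∷ xs) f≡g = cong₂ _+_ (f≡g x) (∑-cong xs f≡g)

  ∑-mono : ∀ (xs : List B) {f g : B → ℕ} → (∀ x → f x ≤ g x) → ∑ xs f ≤ ∑ xs g
  ∑-mono []       f≤g = ≤-refl
  ∑-mono (x ∷ xs) f≤g = +-mono-≤ (f≤g x) (∑-mono xs f≤g)

  ∑-+ : ∀ (xs : List B) (f g : B → ℕ) → ∑[ x ∈ xs ] (f x + g x) ≡ ∑ xs f + ∑ xs g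
  ∑-+ []       f g = refl
  ∑-+ (x ∷ xs) f g = trans (cong (f x + g x +_) (∑-+ xs f g)) (interchange (f x) (g x) _ _)
    where
    interchange : ∀ a b c d → a + b + (c + d) ≡ a + c + (b + d)
    interchange = solve-∀

  ∑-*ˡ : ∀ c (xs : List B) (f : B → ℕ) → ∑[ x ∈ xs ] (c * f x) ≡ c * ∑ xs f
  ∑-*ˡ c []       f = sym (*-zeroʳ c)
  ∑-*ˡ c (x ∷ xs) f = trans (cong (c * f x +_) (∑-*ˡ c xs f)) (sym (*-distribˡ-+ c (f x) _))

  ∑-const : ∀ (xs : List B) c → ∑[ _ ∈ xs ] c ≡ length xs * c
  ∑-const []       c = refl
  ∑-const (x ∷ xs) c = cong (c +_) (∑-const xs c)

  ∑-++ : ∀ (xs ys : List B) (f : B → ℕ) → ∑ (xs ++ ys) f ≡ ∑ xs f + ∑ ys f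
  ∑-++ []       ys f = refl
  ∑-++ (x ∷ xs) ys f = trans (cong (f x +_) (∑-++ xs ys f)) (sym (+-assoc (f x) _ _))

  ∑-map : ∀ {C : Set} (g : C → B) (xs : List C) (f : B → ℕ) → ∑ (map g xs) f ≡ ∑ xs (f ∘ g)
  ∑-map g []       f = refl
  ∑-map g (x ∷ xs) f = cong (f (g x) +_) (∑-map g xs f)

  ∑-concatMap : ∀ {C : Set} (g : C → List B) (xs : List C) (f : B → ℕ) →
                ∑ (concatMap g xs) f ≡ ∑[ x ∈ xs ] ∑ (g x) f
  ∑-concatMap g []       f = refl
  ∑-concatMap g (x ∷ xs) f = trans (∑-++ (g x) (concatMap g xs) f) (cong (∑ (g x) f +_) (∑-concatMap g xs f))

module _ {A : Set} where

  selections : List A → List (A × List A)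
  selections []       = []
  selections (x ∷ xs) = (x , xs) ∷ map (map₂ (x ∷_)) (selections xs)

  ∑-selections-cong : ∀ x xs {f g : A × List A → ℕ} →
                      (∀ a r → length r ≡ length xs → f (a , r) ≡ g (a , r)) →
                      ∑ (selections (x ∷ xs)) f ≡ ∑ (selections (x ∷ xs)) g
  ∑-selections-cong x []       f≡g = cong (_+ 0) (f≡g x [] refl)
  ∑-selections-cong x (y ∷ ys) {f} {g} f≡g = cong₂ _+_ (f≡g x (y ∷ ys) refl) (begin
      ∑ (map (map₂ (x ∷_)) (selections (y ∷ ys))) f  ≡⟨ ∑-map (map₂ (x ∷_)) (selections (y ∷ ys)) f ⟩
      ∑ (selections (y ∷ ys)) (f ∘ map₂ (x ∷_))
        ≡⟨ ∑-selections-cong y ys (λ a r eq → f≡g a (x ∷ r) (cong suc eq)) ⟩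
      ∑ (selections (y ∷ ys)) (g ∘ map₂ (x ∷_))       ≡⟨ ∑-map (map₂ (x ∷_)) (selections (y ∷ ys)) g ⟨
      ∑ (map (map₂ (x ∷_)) (selections (y ∷ ys))) g  ∎)
    where open ≡-Reasoning

  ∑-insertions-cons : ∀ x y ys (h : List A → ℕ) →
                      ∑ (insertions x (y ∷ ys)) h ≡ h (x ∷ y ∷ ys) + ∑ (insertions x ys) (h ∘ (y ∷_))
  ∑-insertions-cons x y ys h = cong (h (x ∷ y ∷ ys) +_) (∑-map (y ∷_) (insertions x ys) h)

  ∑-perms-cons : ∀ x xs (h : List A → ℕ) → ∑ (perms (x ∷ xs)) h ≡ ∑[ ρ ∈ perms xs ] ∑ (insertions x ρ) h
  ∑-perms-cons x xs h = ∑-concatMap (insertions x) (perms xs) h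

  ∑-perms-selections : ∀ x xs (h : List A → ℕ) →
                       ∑ (perms (x ∷ xs)) h ≡ ∑ (selections (x ∷ xs)) (uncurry λ a r → ∑[ ρ ∈ perms r ] h (a ∷ ρ))
  ∑-perms-selections x []       h = sym (+-identityʳ _)
  ∑-perms-selections x (y ∷ ys) h = begin
      ∑ (perms (x ∷ y ∷ ys)) h
        ≡⟨ ∑-perms-cons x (y ∷ ys) h ⟩
      ∑[ ρ ∈ perms (y ∷ ys) ] ∑ (insertions x ρ) h
        ≡⟨ ∑-perms-selections y ys (λ ρ → ∑ (insertions x ρ) h) ⟩
      ∑ (selections (y ∷ ys)) (uncurry λ b r → ∑[ ρ ∈ perms r ] ∑ (insertions x (b ∷ ρ)) h)
        ≡⟨ ∑-cong (selections (y ∷ ys)) (uncurry split) ⟩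
      ∑ (selections (y ∷ ys)) (uncurry λ b r → ∑[ ρ ∈ perms r ] h (x ∷ b ∷ ρ) + ∑[ ρ ∈ perms (x ∷ r) ] h (b ∷ ρ))
        ≡⟨ ∑-+ (selections (y ∷ ys)) (uncurry λ b r → ∑[ ρ ∈ perms r ] h (x ∷ b ∷ ρ))
                                      (uncurry λ b r → ∑[ ρ ∈ perms (x ∷ r) ] h (b ∷ ρ)) ⟩
      ∑ (selections (y ∷ ys)) (uncurry λ b r → ∑[ ρ ∈ perms r ] h (x ∷ b ∷ ρ))
        + ∑ (selections (y ∷ ys)) (uncurry λ b r → ∑[ ρ ∈ perms (x ∷ r) ] h (b ∷ ρ))
        ≡⟨ cong₂ _+_ (∑-perms-selections y ys (h ∘ (x ∷_))) (∑-map (map₂ (x ∷_)) (selections (y ∷ ys)) _) ⟨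
      ∑ (selections (x ∷ y ∷ ys)) (uncurry λ a r → ∑[ ρ ∈ perms r ] h (a ∷ ρ)) ∎
    where
    open ≡-Reasoning
    split : ∀ b r → ∑[ ρ ∈ perms r ] ∑ (insertions x (b ∷ ρ)) h
                  ≡ ∑[ ρ ∈ perms r ] h (x ∷ b ∷ ρ) + ∑[ ρ ∈ perms (x ∷ r) ] h (b ∷ ρ)
    split b r = begin
      ∑[ ρ ∈ perms r ] ∑ (insertions x (b ∷ ρ)) h
        ≡⟨ ∑-cong (perms r) (λ ρ → ∑-insertions-cons x b ρ h) ⟩
      ∑[ ρ ∈ perms r ] (h (x ∷ b ∷ ρ) + ∑ (insertions x ρ) (h ∘ (b ∷_)))
        ≡⟨ ∑-+ (perms r) _ _ ⟩
      ∑[ ρ ∈ perms r ] h (x ∷ b ∷ ρ) + ∑[ ρ ∈ perms r ] ∑ (insertions x ρ) (h ∘ (b ∷_))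
        ≡⟨ cong (∑[ ρ ∈ perms r ] h (x ∷ b ∷ ρ) +_) (∑-perms-cons x r (h ∘ (b ∷_))) ⟨
      ∑[ ρ ∈ perms r ] h (x ∷ b ∷ ρ) + ∑[ ρ ∈ perms (x ∷ r) ] h (b ∷ ρ) ∎

  ∑-insertions-comm : ∀ x y ρ (h : List A → ℕ) →
                      ∑[ ι ∈ insertions y ρ ] ∑ (insertions x ι) h ≡ ∑[ ι ∈ insertions x ρ ] ∑ (insertions y ι) h
  ∑-insertions-comm x y []      h = cong (_+ 0) (swap-heads (h (x ∷ y ∷ [])) (h (y ∷ x ∷ [])))
    where
    swap-heads : ∀ a b → a + (b + 0) ≡ b + (a + 0)
    swap-heads = solve-∀
  ∑-insertions-comm x y (z ∷ ρ) h = begin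
      ∑[ ι ∈ insertions y (z ∷ ρ) ] ∑ (insertions x ι) h
        ≡⟨ expand x y ⟩
      (h (x ∷ y ∷ z ∷ ρ) + (h (y ∷ x ∷ z ∷ ρ) + ∑[ ι ∈ insertions x ρ ] h (y ∷ z ∷ ι)))
        + (∑[ ι ∈ insertions y ρ ] h (x ∷ z ∷ ι) + ∑[ ι ∈ insertions y ρ ] ∑ (insertions x ι) (h ∘ (z ∷_)))
        ≡⟨ rearrange (h (x ∷ y ∷ z ∷ ρ)) (h (y ∷ x ∷ z ∷ ρ)) (∑[ ι ∈ insertions x ρ ] h (y ∷ z ∷ ι))
                     (∑[ ι ∈ insertions y ρ ] h (x ∷ z ∷ ι)) (∑-insertions-comm x y ρ (h ∘ (z ∷_))) ⟩
      (h (y ∷ x ∷ z ∷ ρ) + (h (x ∷ y ∷ z ∷ ρ) + ∑[ ι ∈ insertions y ρ ] h (x ∷ z ∷ ι)))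
        + (∑[ ι ∈ insertions x ρ ] h (y ∷ z ∷ ι) + ∑[ ι ∈ insertions x ρ ] ∑ (insertions y ι) (h ∘ (z ∷_)))
        ≡⟨ expand y x ⟨
      ∑[ ι ∈ insertions x (z ∷ ρ) ] ∑ (insertions y ι) h ∎
    where
    open ≡-Reasoning
    expand : ∀ x y →
      ∑[ ι ∈ insertions y (z ∷ ρ) ] ∑ (insertions x ι) h
        ≡ (h (x ∷ y ∷ z ∷ ρ) + (h (y ∷ x ∷ z ∷ ρ) + ∑[ ι ∈ insertions x ρ ] h (y ∷ z ∷ ι)))
          + (∑[ ι ∈ insertions y ρ ] h (x ∷ z ∷ ι) + ∑[ ι ∈ insertions y ρ ] ∑ (insertions x ι) (h ∘ (z ∷_)))
    expand x y = cong₂ _+_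
      (trans (∑-insertions-cons x y (z ∷ ρ) h) (cong (h (x ∷ y ∷ z ∷ ρ) +_) (∑-insertions-cons x z ρ (h ∘ (y ∷_)))))
      (trans (∑-map (z ∷_) (insertions y ρ) _)
        (trans (∑-cong (insertions y ρ) (λ ι → ∑-insertions-cons x z ι h)) (∑-+ (insertions y ρ) _ _)))
    rearrange : ∀ a b c d {e e′} → e ≡ e′ → (a + (b + c)) + (d + e) ≡ (b + (a + d)) + (c + e′)
    rearrange a b c d {e} refl = lemma a b c d e
      where
      lemma : ∀ a b c d e → (a + (b + c)) + (d + e) ≡ (b + (a + d)) + (c + e)
      lemma = solve-∀

  ∑-perms-↭ : ∀ (h : List A → ℕ) {xs ys} → xs ↭ ys → ∑ (perms xs) h ≡ ∑ (perms ys) h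
  ∑-perms-↭ h ↭.refl                      = refl
  ∑-perms-↭ h (↭.prep {xs} {ys} x xs↭ys) = begin
    ∑ (perms (x ∷ xs)) h                          ≡⟨ ∑-perms-cons x xs h ⟩
    ∑[ ρ ∈ perms xs ] ∑ (insertions x ρ) h        ≡⟨ ∑-perms-↭ (λ ρ → ∑ (insertions x ρ) h) xs↭ys ⟩
    ∑[ ρ ∈ perms ys ] ∑ (insertions x ρ) h        ≡⟨ ∑-perms-cons x ys h ⟨
    ∑ (perms (x ∷ ys)) h                          ∎
    where open ≡-Reasoning
  ∑-perms-↭ h (↭.swap {xs} {ys} x y xs↭ys) = begin
    ∑ (perms (x ∷ y ∷ xs)) h                                           ≡⟨ ∑-perms-cons₂ x y xs ⟩
    ∑[ ρ ∈ perms xs ] ∑[ ι ∈ insertions y ρ ] ∑ (insertions x ι) h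
      ≡⟨ ∑-cong (perms xs) (λ ρ → ∑-insertions-comm x y ρ h) ⟩
    ∑[ ρ ∈ perms xs ] ∑[ ι ∈ insertions x ρ ] ∑ (insertions y ι) h    ≡⟨ ∑-perms-↭ _ xs↭ys ⟩
    ∑[ ρ ∈ perms ys ] ∑[ ι ∈ insertions x ρ ] ∑ (insertions y ι) h    ≡⟨ ∑-perms-cons₂ y x ys ⟨
    ∑ (perms (y ∷ x ∷ ys)) h                                           ∎
    where
    open ≡-Reasoning
    ∑-perms-cons₂ : ∀ x y xs →
                    ∑ (perms (x ∷ y ∷ xs)) h ≡ ∑[ ρ ∈ perms xs ] ∑[ ι ∈ insertions y ρ ] ∑ (insertions x ι) h
    ∑-perms-cons₂ x y xs = trans (∑-perms-cons x (y ∷ xs) h) (∑-perms-cons y xs _)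
  ∑-perms-↭ h (↭.trans p q) = trans (∑-perms-↭ h p) (∑-perms-↭ h q)

  choose : ℕ → List A → List (List A)
  choose zero    xs       = [ [] ]
  choose (suc k) []       = []
  choose (suc k) (x ∷ xs) = map (x ∷_) (choose k xs) ++ choose (suc k) xs

  ∑-choose-cons : ∀ k x xs (f : List A → ℕ) →
                  ∑ (choose (suc k) (x ∷ xs)) f ≡ ∑ (choose k xs) (f ∘ (x ∷_)) + ∑ (choose (suc k) xs) f
  ∑-choose-cons k x xs f =
    trans (∑-++ (map (x ∷_) (choose k xs)) _ f) (cong (_+ ∑ (choose (suc k) xs) f) (∑-map (x ∷_) (choose k xs) f))

  ∑-choose-1 : ∀ xs (f : List A → ℕ) → ∑ (choose 1 xs) f ≡ ∑[ x ∈ xs ] f [ x ]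
  ∑-choose-1 []       f = refl
  ∑-choose-1 (x ∷ xs) f = cong (f [ x ] +_) (∑-choose-1 xs f)

  ∑-choose-suc-cong : ∀ k xs {f g : List A → ℕ} → (∀ x s → f (x ∷ s) ≡ g (x ∷ s)) →
                      ∑ (choose (suc k) xs) f ≡ ∑ (choose (suc k) xs) g
  ∑-choose-suc-cong k []       f≡g = refl
  ∑-choose-suc-cong k (x ∷ xs) {f} {g} f≡g = begin
    ∑ (choose (suc k) (x ∷ xs)) f                           ≡⟨ ∑-choose-cons k x xs f ⟩
    ∑ (choose k xs) (f ∘ (x ∷_)) + ∑ (choose (suc k) xs) f  ≡⟨ cong₂ _+_ (∑-cong (choose k xs) (f≡g x))
                                                                           (∑-choose-suc-cong k xs f≡g) ⟩
    ∑ (choose k xs) (g ∘ (x ∷_)) + ∑ (choose (suc k) xs) g  ≡⟨ ∑-choose-cons k x xs g ⟨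
    ∑ (choose (suc k) (x ∷ xs)) g                           ∎
    where open ≡-Reasoning

  ∑-selections-choose : ∀ k (H : A → List A → ℕ) xs →
                        ∑ (selections xs) (uncurry λ a r → ∑ (choose k r) (H a))
                          ≡ ∑[ t ∈ choose (suc k) xs ] ∑ (selections t) (uncurry H)
  ∑-selections-choose k H []       = refl
  ∑-selections-choose k H (x ∷ xs) = begin
      ∑ (choose k xs) (H x) + ∑ (map (map₂ (x ∷_)) (selections xs)) (uncurry λ a r → ∑ (choose k r) (H a))
    ≡⟨ cong (∑ (choose k xs) (H x) +_) (trans (∑-map (map₂ (x ∷_)) (selections xs) _) (rest k)) ⟩
      ∑ (choose k xs) (H x) + (∑[ s ∈ choose k xs ] ∑ (selections s) (uncurry λ a u → H a (x ∷ u)) + T)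
    ≡⟨ +-assoc (∑ (choose k xs) (H x)) _ T ⟨
      ∑ (choose k xs) (H x) + ∑[ s ∈ choose k xs ] ∑ (selections s) (uncurry λ a u → H a (x ∷ u)) + T
    ≡⟨ cong (_+ T) (∑-+ (choose k xs) (H x) (λ s → ∑ (selections s) (uncurry λ a u → H a (x ∷ u)))) ⟨
      ∑[ s ∈ choose k xs ] (H x s + ∑ (selections s) (uncurry λ a u → H a (x ∷ u))) + T
    ≡⟨ cong (_+ T) (∑-cong (choose k xs) (λ s → cong (H x s +_) (∑-map (map₂ (x ∷_)) (selections s) (uncurry H)))) ⟨
      ∑[ s ∈ choose k xs ] ∑ (selections (x ∷ s)) (uncurry H) + T
    ≡⟨ ∑-choose-cons k x xs (λ t → ∑ (selections t) (uncurry H)) ⟨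
      ∑[ t ∈ choose (suc k) (x ∷ xs) ] ∑ (selections t) (uncurry H)
    ∎
    where
    open ≡-Reasoning
    T : ℕ
    T = ∑[ t ∈ choose (suc k) xs ] ∑ (selections t) (uncurry H)
    rest : ∀ i → ∑ (selections xs) (uncurry λ a r → ∑ (choose i (x ∷ r)) (H a))
                 ≡ ∑[ s ∈ choose i xs ] ∑ (selections s) (uncurry λ a u → H a (x ∷ u))
                   + ∑[ t ∈ choose (suc i) xs ] ∑ (selections t) (uncurry H)
    rest zero    = ∑-selections-choose zero H xs
    rest (suc j) = begin
      ∑ (selections xs) (uncurry λ a r → ∑ (choose (suc j) (x ∷ r)) (H a))
        ≡⟨ ∑-cong (selections xs) (uncurry λ a r → ∑-choose-cons j x r (H a)) ⟩
      ∑ (selections xs) (uncurry λ a r → ∑ (choose j r) (H a ∘ (x ∷_)) + ∑ (choose (suc j) r) (H a))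
        ≡⟨ ∑-+ (selections xs) (uncurry λ a r → ∑ (choose j r) (H a ∘ (x ∷_)))
                               (uncurry λ a r → ∑ (choose (suc j) r) (H a)) ⟩
      ∑ (selections xs) (uncurry λ a r → ∑ (choose j r) (H a ∘ (x ∷_)))
        + ∑ (selections xs) (uncurry λ a r → ∑ (choose (suc j) r) (H a))
        ≡⟨ cong₂ _+_ (∑-selections-choose j (λ a → H a ∘ (x ∷_)) xs) (∑-selections-choose (suc j) H xs) ⟩
      ∑[ s ∈ choose (suc j) xs ] ∑ (selections s) (uncurry λ a u → H a (x ∷ u))
        + ∑[ t ∈ choose (suc (suc j)) xs ] ∑ (selections t) (uncurry H) ∎

  ∑-selections-choose-perms : ∀ k (h : List A → ℕ) xs →
                              ∑ (selections xs) (uncurry λ a r → ∑[ s ∈ choose k r ] ∑[ π ∈ perms s ] h (a ∷ π))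
                                ≡ ∑[ t ∈ choose (suc k) xs ] ∑ (perms t) h
  ∑-selections-choose-perms k h xs =
    trans (∑-selections-choose k (λ a s → ∑[ π ∈ perms s ] h (a ∷ π)) xs)
          (∑-choose-suc-cong k xs λ b t → sym (∑-perms-selections b t h))

  -- A k-subset of xs avoids exactly length xs ∸ k of the selected elements.
  ∑-selections-choose-count : ∀ k (f : List A → ℕ) xs →
                              ∑ (selections xs) (uncurry λ _ r → ∑ (choose k r) f) + k * ∑ (choose k xs) f
                                ≡ length xs * ∑ (choose k xs) f
  ∑-selections-choose-count zero    f []       = refl
  ∑-selections-choose-count (suc k) f []       = *-zeroʳ (suc k)
  ∑-selections-choose-count zero    f (x ∷ xs) =
    trans (+-identityʳ _) (cong (f [] + 0 +_) (begin
      ∑ (map (map₂ (x ∷_)) (selections xs)) (λ _ → f [] + 0)  ≡⟨ ∑-map (map₂ (x ∷_)) (selections xs) _ ⟩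
      ∑ (selections xs) (λ _ → f [] + 0)                      ≡⟨ +-identityʳ _ ⟨
      ∑ (selections xs) (λ _ → f [] + 0) + 0                  ≡⟨ ∑-selections-choose-count zero f xs ⟩
      length xs * (f [] + 0)                                  ∎))
    where open ≡-Reasoning
  ∑-selections-choose-count (suc k) f (x ∷ xs) = begin
      C + ∑ (map (map₂ (x ∷_)) (selections xs)) (uncurry λ _ r → ∑ (choose (suc k) r) f)
        + suc k * ∑ (choose (suc k) (x ∷ xs)) f
    ≡⟨ cong₂ (λ M S → C + M + suc k * S) split (∑-choose-cons k x xs f) ⟩
      C + (X₁ + X₂) + suc k * (P + C)
    ≡⟨ regroup C X₁ X₂ P k ⟩
      (X₁ + k * P) + (X₂ + suc k * C) + (P + C)
    ≡⟨ cong₂ (λ a b → a + b + (P + C)) (∑-selections-choose-count k (f ∘ (x ∷_)) xs)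
                                       (∑-selections-choose-count (suc k) f xs) ⟩
      length xs * P + length xs * C + (P + C)
    ≡⟨ collect (length xs) P C ⟩
      suc (length xs) * (P + C)
    ≡⟨ cong (suc (length xs) *_) (∑-choose-cons k x xs f) ⟨
      suc (length xs) * ∑ (choose (suc k) (x ∷ xs)) f
    ∎
    where
    open ≡-Reasoning
    C P X₁ X₂ : ℕ
    C  = ∑ (choose (suc k) xs) f
    P  = ∑ (choose k xs) (f ∘ (x ∷_))
    X₁ = ∑ (selections xs) (uncurry λ _ r → ∑ (choose k r) (f ∘ (x ∷_)))
    X₂ = ∑ (selections xs) (uncurry λ _ r → ∑ (choose (suc k) r) f)
    split : ∑ (map (map₂ (x ∷_)) (selections xs)) (uncurry λ _ r → ∑ (choose (suc k) r) f) ≡ X₁ + X₂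
    split = trans (∑-map (map₂ (x ∷_)) (selections xs) _)
              (trans (∑-cong (selections xs) (uncurry λ _ r → ∑-choose-cons k x r f)) (∑-+ (selections xs) _ _))
    regroup : ∀ c x₁ x₂ p k → c + (x₁ + x₂) + suc k * (p + c) ≡ (x₁ + k * p) + (x₂ + suc k * c) + (p + c)
    regroup = solve-∀
    collect : ∀ n p c → n * p + n * c + (p + c) ≡ suc n * (p + c)
    collect = solve-∀

  ∑-perms-choose : ∀ n xs → length xs ≡ n → ∀ k (h : List A → ℕ) →
                   k ! * ∑[ σ ∈ perms xs ] ∑ (choose k σ) h ≡ n ! * ∑[ s ∈ choose k xs ] ∑ (perms s) h
  ∑-perms-choose zero    []       _  zero    h = refl
  ∑-perms-choose zero    []       _  (suc k) h = *-zeroʳ (suc k !)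
  ∑-perms-choose (suc n) (x ∷ xs) eq k       h = begin
      k ! * ∑[ σ ∈ perms (x ∷ xs) ] ∑ (choose k σ) h
    ≡⟨ cong (k ! *_) (∑-perms-selections x xs _) ⟩
      k ! * ∑ (selections (x ∷ xs)) (uncurry λ a r → ∑[ ρ ∈ perms r ] ∑ (choose k (a ∷ ρ)) h)
    ≡⟨ ∑-*ˡ (k !) (selections (x ∷ xs)) _ ⟨
      ∑ (selections (x ∷ xs)) (uncurry λ a r → k ! * ∑[ ρ ∈ perms r ] ∑ (choose k (a ∷ ρ)) h)
    ≡⟨ ∑-selections-cong x xs (λ a r e → ∑-perms-choose-cons k a r (trans e (suc-injective eq))) ⟩
      ∑ (selections (x ∷ xs)) (uncurry λ a r → n ! * (k * Head k a r + Rest k r))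
    ≡⟨ ∑-*ˡ (n !) (selections (x ∷ xs)) _ ⟩
      n ! * ∑ (selections (x ∷ xs)) (uncurry λ a r → k * Head k a r + Rest k r)
    ≡⟨ cong (n ! *_) (trans (∑-+ (selections (x ∷ xs)) (uncurry λ a r → k * Head k a r) (uncurry λ _ r → Rest k r))
                            (cong (_+ T) (∑-*ˡ k (selections (x ∷ xs)) (uncurry (Head k))))) ⟩
      n ! * (k * ∑ (selections (x ∷ xs)) (uncurry (Head k)) + T)
    ≡⟨ cong (λ y → n ! * (y + T)) (∑-Head k) ⟩
      n ! * (k * S + T)
    ≡⟨ cong (n ! *_) (trans (+-comm (k * S) T) (∑-selections-choose-count k Sym (x ∷ xs))) ⟩
      n ! * (length (x ∷ xs) * S)
    ≡⟨ cong (λ m → n ! * (m * S)) eq ⟩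
      n ! * (suc n * S)
    ≡⟨ reorder (n !) n S ⟩
      suc n ! * S
    ∎
    where
    open ≡-Reasoning
    Sym : List A → ℕ
    Sym s = ∑ (perms s) h
    S : ℕ
    S = ∑ (choose k (x ∷ xs)) Sym
    -- The k-sublists of a ∷ ρ either start with a (Head, none for k = 0) or lie in ρ (Rest).
    Head : ℕ → A → List A → ℕ
    Head zero    a r = 0
    Head (suc j) a r = ∑[ s ∈ choose j r ] ∑[ π ∈ perms s ] h (a ∷ π)
    Rest : ℕ → List A → ℕ
    Rest k r = ∑ (choose k r) Sym
    T : ℕ
    T = ∑ (selections (x ∷ xs)) (uncurry λ _ r → Rest k r)
    ∑-perms-choose-cons : ∀ k a r → length r ≡ n →
                          k ! * ∑[ ρ ∈ perms r ] ∑ (choose k (a ∷ ρ)) h ≡ n ! * (k * Head k a r + Rest k r)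
    ∑-perms-choose-cons zero    a r e = ∑-perms-choose n r e zero h
    ∑-perms-choose-cons (suc j) a r e = begin
        suc j ! * ∑[ ρ ∈ perms r ] ∑ (choose (suc j) (a ∷ ρ)) h
      ≡⟨ cong (suc j ! *_) (trans (∑-cong (perms r) (λ ρ → ∑-choose-cons j a ρ h)) (∑-+ (perms r) _ _)) ⟩
        suc j ! * (∑[ ρ ∈ perms r ] ∑ (choose j ρ) (h ∘ (a ∷_)) + ∑[ ρ ∈ perms r ] ∑ (choose (suc j) ρ) h)
      ≡⟨ distrib (suc j) (j !) _ _ ⟩
        suc j * (j ! * ∑[ ρ ∈ perms r ] ∑ (choose j ρ) (h ∘ (a ∷_)))
          + suc j ! * ∑[ ρ ∈ perms r ] ∑ (choose (suc j) ρ) h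
      ≡⟨ cong₂ (λ u v → suc j * u + v) (∑-perms-choose n r e j (h ∘ (a ∷_))) (∑-perms-choose n r e (suc j) h) ⟩
        suc j * (n ! * Head (suc j) a r) + n ! * Rest (suc j) r
      ≡⟨ factor (suc j) (n !) (Head (suc j) a r) (Rest (suc j) r) ⟩
        n ! * (suc j * Head (suc j) a r + Rest (suc j) r)
      ∎
      where
      distrib : ∀ k f P Q → k * f * (P + Q) ≡ k * (f * P) + k * f * Q
      distrib = solve-∀
      factor : ∀ k f Y Z → k * (f * Y) + f * Z ≡ f * (k * Y + Z)
      factor = solve-∀
    ∑-Head : ∀ k → k * ∑ (selections (x ∷ xs)) (uncurry (Head k)) ≡ k * ∑ (choose k (x ∷ xs)) Sym
    ∑-Head zero    = refl
    ∑-Head (suc j) = cong (suc j *_) (∑-selections-choose-perms j h (x ∷ xs))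
    reorder : ∀ f n S → f * (suc n * S) ≡ suc n * f * S
    reorder = solve-∀

  length-perms : ∀ (xs : List A) → length (perms xs) ≡ length xs !
  length-perms xs = begin
    length (perms xs)                      ≡⟨ *-identityʳ _ ⟨
    length (perms xs) * 1                  ≡⟨ ∑-const (perms xs) 1 ⟨
    ∑[ _ ∈ perms xs ] 1                    ≡⟨ *-identityˡ _ ⟨
    1 * ∑[ _ ∈ perms xs ] 1                ≡⟨ ∑-perms-choose (length xs) xs refl zero (λ _ → 1) ⟩
    length xs ! * 1                        ≡⟨ *-identityʳ _ ⟩
    length xs !                            ∎
    where open ≡-Reasoning

module _ {n : ℕ} (G : Multigraph n) where

  wedge : List (Fin n) → ℕ
  wedge (a ∷ b ∷ c ∷ []) = mult G b a * mult G b c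
  wedge _                = 0

  prefixWedge : List (Fin n) → List (Fin n) → ℕ
  prefixWedge pre (b ∷ c ∷ []) = edgesTo G b pre * mult G b c
  prefixWedge pre _            = 0

  prefixWedge-snoc : ∀ pre v s → prefixWedge (pre ++ [ v ]) s ≡ prefixWedge pre s + wedge (v ∷ s)
  prefixWedge-snoc pre v []                = refl
  prefixWedge-snoc pre v (b ∷ [])          = refl
  prefixWedge-snoc pre v (b ∷ c ∷ [])      = begin
    edgesTo G b (pre ++ [ v ]) * mult G b c
      ≡⟨ cong (_* mult G b c) (∑-++ pre [ v ] (mult G b)) ⟩
    (edgesTo G b pre + (mult G b v + 0)) * mult G b c
      ≡⟨ cong (λ e → (edgesTo G b pre + e) * mult G b c) (+-identityʳ _) ⟩
    (edgesTo G b pre + mult G b v) * mult G b c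
      ≡⟨ *-distribʳ-+ (mult G b c) (edgesTo G b pre) (mult G b v) ⟩
    edgesTo G b pre * mult G b c + mult G b v * mult G b c
      ∎
    where open ≡-Reasoning
  prefixWedge-snoc pre v (b ∷ c ∷ d ∷ s) = refl

  prefixWedge-[] : ∀ s → prefixWedge [] s ≡ 0
  prefixWedge-[] []                = refl
  prefixWedge-[] (b ∷ [])          = refl
  prefixWedge-[] (b ∷ c ∷ [])      = refl
  prefixWedge-[] (b ∷ c ∷ d ∷ s)   = refl

  scoreFrom-choose : ∀ pre σ → scoreFrom G pre σ ≡ ∑ (choose 2 σ) (prefixWedge pre) + ∑ (choose 3 σ) wedge
  scoreFrom-choose pre []         = refl
  scoreFrom-choose pre (v ∷ post) = begin
      edgesTo G v pre * edgesTo G v post + scoreFrom G (pre ++ [ v ]) post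
    ≡⟨ cong (edgesTo G v pre * edgesTo G v post +_) (scoreFrom-choose (pre ++ [ v ]) post) ⟩
      edgesTo G v pre * edgesTo G v post + (∑ (choose 2 post) (prefixWedge (pre ++ [ v ])) + W₃)
    ≡⟨ cong (λ u → edgesTo G v pre * edgesTo G v post + (u + W₃))
            (trans (∑-cong (choose 2 post) (prefixWedge-snoc pre v)) (∑-+ (choose 2 post) _ _)) ⟩
      edgesTo G v pre * edgesTo G v post + (P₂ + W₂ + W₃)
    ≡⟨ regroup (edgesTo G v pre * edgesTo G v post) P₂ W₂ W₃ ⟩
      (edgesTo G v pre * edgesTo G v post + P₂) + (W₂ + W₃)
    ≡⟨ cong₂ _+_ (cong (_+ P₂) first-edges) (∑-choose-cons 2 v post wedge) ⟨
      (∑ (choose 1 post) (prefixWedge pre ∘ (v ∷_)) + P₂) + ∑ (choose 3 (v ∷ post)) wedge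
    ≡⟨ cong (_+ ∑ (choose 3 (v ∷ post)) wedge) (∑-choose-cons 1 v post (prefixWedge pre)) ⟨
      ∑ (choose 2 (v ∷ post)) (prefixWedge pre) + ∑ (choose 3 (v ∷ post)) wedge
    ∎
    where
    open ≡-Reasoning
    P₂ W₂ W₃ : ℕ
    P₂ = ∑ (choose 2 post) (prefixWedge pre)
    W₂ = ∑ (choose 2 post) (wedge ∘ (v ∷_))
    W₃ = ∑ (choose 3 post) wedge
    first-edges : ∑ (choose 1 post) (prefixWedge pre ∘ (v ∷_)) ≡ edgesTo G v pre * edgesTo G v post
    first-edges = trans (∑-choose-1 post _) (∑-*ˡ (edgesTo G v pre) post (mult G v))
    regroup : ∀ a b c d → a + (b + c + d) ≡ (a + b) + (c + d)
    regroup = solve-∀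

  score-choose : ∀ σ → score G σ ≡ ∑ (choose 3 σ) wedge
  score-choose σ = begin
    score G σ                                                      ≡⟨ scoreFrom-choose [] σ ⟩
    ∑ (choose 2 σ) (prefixWedge []) + ∑ (choose 3 σ) wedge         ≡⟨ cong (_+ ∑ (choose 3 σ) wedge) no-prefix ⟩
    ∑ (choose 3 σ) wedge                                           ∎
    where
    open ≡-Reasoning
    no-prefix : ∑ (choose 2 σ) (prefixWedge []) ≡ 0
    no-prefix = trans (∑-cong (choose 2 σ) prefixWedge-[])
                      (trans (∑-const (choose 2 σ) 0) (*-zeroʳ (length (choose 2 σ))))

  -- perms (a ∷ b ∷ c ∷ []) lists a b c first and its reversal c b a last; both have middle
  -- vertex b, hence the same wedge.
  twice-wedge-≤ : ∀ s → 2 * wedge s ≤ ∑ (perms s) wedge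
  twice-wedge-≤ []              = z≤n
  twice-wedge-≤ (a ∷ [])        = z≤n
  twice-wedge-≤ (a ∷ b ∷ [])    = z≤n
  twice-wedge-≤ (a ∷ b ∷ c ∷ []) =
    twice-≤ (wedge (a ∷ b ∷ c ∷ [])) (wedge (b ∷ a ∷ c ∷ [])) (wedge (b ∷ c ∷ a ∷ []))
            (wedge (a ∷ c ∷ b ∷ [])) (wedge (c ∷ a ∷ b ∷ [])) (*-comm (mult G b a) (mult G b c))
    where
    twice-≤ : ∀ u x₂ x₃ x₄ x₅ {v} → u ≡ v → 2 * u ≤ u + (x₂ + (x₃ + (x₄ + (x₅ + (v + 0)))))
    twice-≤ u x₂ x₃ x₄ x₅ refl =
      subst (2 * u ≤_) (regroup u x₂ x₃ x₄ x₅) (m≤m+n (2 * u) (x₂ + x₃ + x₄ + x₅))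
      where
      regroup : ∀ u x₂ x₃ x₄ x₅ → 2 * u + (x₂ + x₃ + x₄ + x₅) ≡ u + (x₂ + (x₃ + (x₄ + (x₅ + (u + 0)))))
      regroup = solve-∀
  twice-wedge-≤ (a ∷ b ∷ c ∷ d ∷ s) = z≤n

  twice-score-≤ : ∀ σ → 2 * score G σ ≤ ∑[ s ∈ choose 3 σ ] ∑ (perms s) wedge
  twice-score-≤ σ = begin
    2 * score G σ                        ≡⟨ cong (2 *_) (score-choose σ) ⟩
    2 * ∑ (choose 3 σ) wedge             ≡⟨ ∑-*ˡ 2 (choose 3 σ) wedge ⟨
    ∑[ s ∈ choose 3 σ ] (2 * wedge s)    ≤⟨ ∑-mono (choose 3 σ) twice-wedge-≤ ⟩
    ∑[ s ∈ choose 3 σ ] ∑ (perms s) wedge ∎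
    where open ≤-Reasoning

theorem17 : ∀ (n : ℕ) (G : Multigraph n) (τ : List (Fin n)) → τ ↭ allFin n →
    length (perms (allFin n)) * score G τ ≤ 3 * sum (map (score G) (perms (allFin n)))
theorem17 n G τ τ↭allFin = *-cancelˡ-≤ 2 (begin
    2 * (N * score G τ)                             ≡⟨ x∙yz≈y∙xz 2 N (score G τ) ⟩
    N * (2 * score G τ)                             ≤⟨ *-monoʳ-≤ N (twice-score-≤ G τ) ⟩
    N * T                                           ≡⟨ cong (_* T) N≡|τ|! ⟩
    length τ ! * T                                  ≡⟨ ∑-perms-choose (length τ) τ refl 3 (wedge G) ⟨
    6 * ∑[ σ ∈ perms τ ] ∑ (choose 3 σ) (wedge G)  ≡⟨ cong (6 *_) (∑-cong (perms τ) (sym ∘ score-choose G)) ⟩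
    6 * ∑ (perms τ) (score G)                       ≡⟨ cong (6 *_) (∑-perms-↭ (score G) τ↭allFin) ⟩
    6 * Σscore                                      ≡⟨ *-assoc 2 3 Σscore ⟩
    2 * (3 * Σscore)                                ∎)
  where
  open ≤-Reasoning
  N T Σscore : ℕ
  N      = length (perms (allFin n))
  T      = ∑[ s ∈ choose 3 τ ] ∑ (perms s) (wedge G)
  Σscore = ∑ (perms (allFin n)) (score G)
  N≡|τ|! : N ≡ length τ !
  N≡|τ|! = trans (length-perms (allFin n)) (cong _! (↭-length (↭-sym τ↭allFin)))
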